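{- Let $\mathbf{F}$ be a field and let $A=\{0,1,a,b\}\subseteq\mathbf{F}$ have cardinality $4$. For a finite set $S\subseteq\mathbf{F}$, let $\mathcal{E}(S)$ be the set of all $c\in\mathbf{F}$ such that the map $(s_1,s_2)\mapsto s_1+cs_2$ is not injective on $S^2$, and for $c\neq 0$ let $E(c)=\{c,-c,1/c,-1/c\}$. Then \begin{align*} \mathcal{E}(\{0,1,a,b\}) = {}& \mathcal{E}(\{0,1,a\})\cup\mathcal{E}(\{0,1,b\})\\ &\cup E(a-b)\cup E\!\left(\frac{a-b}{a}\right)\cup E\!\left(\frac{a-b}{b}\right)\\ &\cup E\!\left(\frac{a-1}{b}\right)\cup E\!\left(\frac{b-1}{a}\right)\cup E\!\left(\frac{a-1}{b-1}\right)\\ &\cup E\!\left(\frac{a-1}{a-b}\right)\cup E\!\left(\frac{b-1}{a-b}\right)\cup E\!\left(\frac{a}{b}\right). \end{align*}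
   Context: Equivalently, $c\in\mathcal{E}(S)$ iff $S$ is not a Sidon set for the form $x_1+cx_2$, where a set $S$ is a Sidon set for a form $\varphi$ in $h$ variables if $\varphi$ is injective on $S^h$. (For a three-element set $\{0,1,x\}$ with $x\neq0,1$, one has $\mathcal{E}(\{0,1,x\})=\{0,\pm1\}\cup E(x)\cup E(x-1)\cup E((x-1)/x)$.) -}

module Defs where

open import Level using (Level; _⊔_; suc)
open import Algebra.Bundles using (CommutativeRing)
open import Data.Product using (Σ; ∃; _×_; _,_)
open import Data.Sum using (_⊎_)
open import Relation.Nullary using (¬_)

record Field (c ℓ : Level) : Set (suc (c ⊔ ℓ)) where
  field
    commutativeRing : CommutativeRing c ℓ
  open CommutativeRing commutativeRing public
  field
    1≉0     : ¬ (1# ≈ 0#)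
    inverse : ∀ x → ¬ (x ≈ 0#) → ∃ λ y → x * y ≈ 1#

module FieldDefs {c ℓ : Level} (F : Field c ℓ) where
  open Field F

  ⟦0,1,_⟧ : Carrier → Carrier → Set ℓ
  ⟦0,1, a ⟧ x = x ≈ 0# ⊎ x ≈ 1# ⊎ x ≈ a

  ⟦0,1,_,_⟧ : Carrier → Carrier → Carrier → Set ℓ
  ⟦0,1, a , b ⟧ x = x ≈ 0# ⊎ x ≈ 1# ⊎ x ≈ a ⊎ x ≈ b

  𝓔 : (Carrier → Set ℓ) → Carrier → Set (c ⊔ ℓ)
  𝓔 S z = Σ Carrier λ s₁ → Σ Carrier λ s₂ → Σ Carrier λ t₁ → Σ Carrier λ t₂ →
            S s₁ × S s₂ × S t₁ × S t₂ ×
            ¬ (s₁ ≈ t₁ × s₂ ≈ t₂) ×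
            (s₁ + z * s₂ ≈ t₁ + z * t₂)

  -- x ∈ E(u / v) for u, v ≠ 0, where E(c) = {c, -c, 1/c, -1/c}.
  -- Division is unfolded: x = u/v ⇔ x v = u (v ≠ 0), x = v/u ⇔ x u = v (u ≠ 0).
  E[_/_] : Carrier → Carrier → Carrier → Set ℓ
  E[ u / v ] x = x * v ≈ u ⊎ x * v ≈ - u ⊎ x * u ≈ v ⊎ x * u ≈ - v

  E[_] : Carrier → Carrier → Set ℓ
  E[ u ] x = E[ u / 1# ] x

{-# OPTIONS --safe #-}
module Submission where

-- z ∈ 𝓔(S) exactly when z maps a nonzero element v of S − S to an element u
-- of S − S, since s₁ + z s₂ = t₁ + z t₂ means z (t₂ − s₂) = s₁ − t₁.  For u = 0
-- this gives z = 0 ∈ 𝓔({0,1,a}).  The nonzero differences of {0,1,a,b} are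
-- ±1, ±a, ±b, ±(a−1), ±(b−1), ±(a−b), so otherwise z w = ±w′ for two of these
-- six values, i.e. z ∈ E(w′/w).  Pairs drawn from {1, a, a−1} or from
-- {1, b, b−1} are differences of {0,1,a} or {0,1,b}; the pair (a−b, a−b) forces
-- z = ±1 ∈ 𝓔({0,1,a}); the nine remaining unordered pairs are the nine sets
-- E(·) of the statement.

open import Defs
open import Level using (Level; _⊔_)
open import Data.Sum using (_⊎_; inj₁; inj₂; [_,_]′; map₂)
import Data.Sum as Sum
open import Data.Empty using (⊥-elim)
open import Function using (_∘_)
open import Function.Bundles using (_⇔_; mk⇔; Equivalence)
open import Relation.Nullary using (¬_)
import Algebra.Properties.AbelianGroup as AbelianGroupProperties
import Algebra.Properties.Ring as RingProperties
import Algebra.Properties.CommutativeSemigroup as CommutativeSemigroupProperties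

module FieldProperties {c ℓ : Level} (F : Field c ℓ) where
  open Field F
  open import Data.Product using (_,_)
  open AbelianGroupProperties +-abelianGroup
  open RingProperties ring using (-‿distribˡ-*; -‿distribʳ-*)
  open CommutativeSemigroupProperties +-commutativeSemigroup using (interchange)
  open import Relation.Binary.Reasoning.Setoid setoid

  x-0≈x : ∀ x → x - 0# ≈ x
  x-0≈x x = trans (+-congˡ ε⁻¹≈ε) (+-identityʳ x)

  0-x≈-x : ∀ x → 0# - x ≈ - x
  0-x≈-x x = +-identityˡ (- x)

  x-y≈-[y-x] : ∀ x y → x - y ≈ - (y - x)
  x-y≈-[y-x] x y = sym (⁻¹-anti-homo‿- y x)

  x-y≈0⇒x≈y : ∀ {x y} → x - y ≈ 0# → x ≈ y
  x-y≈0⇒x≈y = x∙y⁻¹≈ε⇒x≈y _ _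

  x≈y⇒x-y≈0 : ∀ {x y} → x ≈ y → x - y ≈ 0#
  x≈y⇒x-y≈0 = x≈y⇒x∙y⁻¹≈ε

  x*-y≈-[x*y] : ∀ x y → x * - y ≈ - (x * y)
  x*-y≈-[x*y] x y = sym (-‿distribʳ-* x y)

  [x+y]-[u+v]≈[x-u]-[v-y] : ∀ x y u v → (x + y) - (u + v) ≈ (x - u) - (v - y)
  [x+y]-[u+v]≈[x-u]-[v-y] x y u v = begin
    (x + y) - (u + v)      ≈⟨ +-congˡ (sym (⁻¹-∙-comm u v)) ⟩
    (x + y) + (- u + - v)  ≈⟨ interchange x y (- u) (- v) ⟩
    (x - u) + (y - v)      ≈⟨ +-congˡ (x-y≈-[y-x] y v) ⟩
    (x - u) - (v - y)      ∎

  x+y≈u+v⇒x-u≈v-y : ∀ {x y u v} → x + y ≈ u + v → x - u ≈ v - y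
  x+y≈u+v⇒x-u≈v-y {x} {y} {u} {v} eq =
    x-y≈0⇒x≈y (trans (sym ([x+y]-[u+v]≈[x-u]-[v-y] x y u v)) (x≈y⇒x-y≈0 eq))

  x-u≈v-y⇒x+y≈u+v : ∀ {x y u v} → x - u ≈ v - y → x + y ≈ u + v
  x-u≈v-y⇒x+y≈u+v {x} {y} {u} {v} eq =
    x-y≈0⇒x≈y (trans ([x+y]-[u+v]≈[x-u]-[v-y] x y u v) (x≈y⇒x-y≈0 eq))

  x*y≈0⇒x≈0 : ∀ {x y} → ¬ (y ≈ 0#) → x * y ≈ 0# → x ≈ 0#
  x*y≈0⇒x≈0 {x} {y} y≉0 xy≈0 with inverse y y≉0
  ... | y⁻¹ , yy⁻¹≈1 = begin
    x               ≈⟨ sym (*-identityʳ x) ⟩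
    x * 1#          ≈⟨ *-congˡ (sym yy⁻¹≈1) ⟩
    x * (y * y⁻¹)   ≈⟨ sym (*-assoc x y y⁻¹) ⟩
    (x * y) * y⁻¹   ≈⟨ *-congʳ xy≈0 ⟩
    0# * y⁻¹        ≈⟨ zeroˡ y⁻¹ ⟩
    0#              ∎

  *-cancelʳ-nonzero : ∀ {x x′ y} → ¬ (y ≈ 0#) → x * y ≈ x′ * y → x ≈ x′
  *-cancelʳ-nonzero {x} {x′} {y} y≉0 eq = x-y≈0⇒x≈y (x*y≈0⇒x≈0 y≉0 (begin
    (x - x′) * y       ≈⟨ distribʳ y x (- x′) ⟩
    x * y + - x′ * y   ≈⟨ +-congˡ (sym (-‿distribˡ-* x′ y)) ⟩
    x * y - x′ * y     ≈⟨ x≈y⇒x-y≈0 eq ⟩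
    0#                 ∎))

  infix 4 _≈±_
  _≈±_ : Carrier → Carrier → Set ℓ
  x ≈± y = x ≈ y ⊎ x ≈ - y

  ≈±-respˡ : ∀ {x y u} → x ≈ y → y ≈± u → x ≈± u
  ≈±-respˡ x≈y = Sum.map (trans x≈y) (trans x≈y)

  ≈±-sym : ∀ {x y} → x ≈± y → y ≈± x
  ≈±-sym (inj₁ x≈y)  = inj₁ (sym x≈y)
  ≈±-sym (inj₂ x≈-y) = inj₂ (trans (sym (⁻¹-involutive _)) (-‿cong (sym x≈-y)))

  ≈±-trans : ∀ {x y u} → x ≈± y → y ≈± u → x ≈± u
  ≈±-trans (inj₁ x≈y)  y≈±u          = ≈±-respˡ x≈y y≈±u
  ≈±-trans (inj₂ x≈-y) (inj₁ y≈u)    = inj₂ (trans x≈-y (-‿cong y≈u))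
  ≈±-trans (inj₂ x≈-y) (inj₂ y≈-u)   =
    inj₁ (trans x≈-y (trans (-‿cong y≈-u) (⁻¹-involutive _)))

  *-preserves-≈± : ∀ z {x y} → x ≈± y → z * x ≈± z * y
  *-preserves-≈± z (inj₁ x≈y)  = inj₁ (*-congˡ x≈y)
  *-preserves-≈± z (inj₂ x≈-y) = inj₂ (trans (*-congˡ x≈-y) (x*-y≈-[x*y] z _))

module Dilations {c ℓ : Level} (F : Field c ℓ) where
  open Field F
  open import Data.Product using (Σ; _×_; _,_; proj₂)
  open FieldDefs F
  open FieldProperties F
  open RingProperties ring using (x[y-z]≈xy-xz)

  Difference : (Carrier → Set ℓ) → Carrier → Set (c ⊔ ℓ)
  Difference S u = Σ Carrier λ p → Σ Carrier λ q → S p × S q × u ≈ p - q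

  NonzeroDifference : (Carrier → Set ℓ) → Carrier → Set (c ⊔ ℓ)
  NonzeroDifference S u = ¬ (u ≈ 0#) × Difference S u

  ScalesDifference : (Carrier → Set ℓ) → Carrier → Set (c ⊔ ℓ)
  ScalesDifference S z = Σ Carrier λ v → Σ Carrier λ u →
    NonzeroDifference S v × Difference S u × z * v ≈ u

  module _ {S : Carrier → Set ℓ} where

    Difference-neg : ∀ {u} → Difference S u → Difference S (- u)
    Difference-neg (p , q , p∈ , q∈ , u≈p-q) =
      q , p , q∈ , p∈ , trans (-‿cong u≈p-q) (sym (x-y≈-[y-x] q p))

    Difference-mono : ∀ {T : Carrier → Set ℓ} → (∀ {x} → S x → T x) →
                      ∀ {u} → Difference S u → Difference T u
    Difference-mono S⊆T (p , q , p∈ , q∈ , eq) = p , q , S⊆T p∈ , S⊆T q∈ , eq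

    NonzeroDifference-mono : ∀ {T : Carrier → Set ℓ} → (∀ {x} → S x → T x) →
                             ∀ {u} → NonzeroDifference S u → NonzeroDifference T u
    NonzeroDifference-mono S⊆T (u≉0 , du) = u≉0 , Difference-mono S⊆T du

    𝓔-mono : ∀ {T : Carrier → Set ℓ} → (∀ {x} → S x → T x) → ∀ {z} → 𝓔 S z → 𝓔 T z
    𝓔-mono S⊆T (s₁ , s₂ , t₁ , t₂ , s₁∈ , s₂∈ , t₁∈ , t₂∈ , ne , eq) =
      s₁ , s₂ , t₁ , t₂ , S⊆T s₁∈ , S⊆T s₂∈ , S⊆T t₁∈ , S⊆T t₂∈ , ne , eq

    𝓔⇔ScalesDifference : ∀ {z} → 𝓔 S z ⇔ ScalesDifference S z
    𝓔⇔ScalesDifference {z} = mk⇔ to from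
      where
      to : 𝓔 S z → ScalesDifference S z
      to (s₁ , s₂ , t₁ , t₂ , s₁∈ , s₂∈ , t₁∈ , t₂∈ , ne , eq) =
        t₂ - s₂ , s₁ - t₁ , (t₂-s₂≉0 , t₂ , s₂ , t₂∈ , s₂∈ , refl) ,
        (s₁ , t₁ , s₁∈ , t₁∈ , refl) , z[t₂-s₂]≈s₁-t₁
        where
        z[t₂-s₂]≈s₁-t₁ : z * (t₂ - s₂) ≈ s₁ - t₁
        z[t₂-s₂]≈s₁-t₁ = trans (x[y-z]≈xy-xz z t₂ s₂) (sym (x+y≈u+v⇒x-u≈v-y eq))

        t₂-s₂≉0 : ¬ (t₂ - s₂ ≈ 0#)
        t₂-s₂≉0 t₂-s₂≈0 = ne
          ( x-y≈0⇒x≈y (trans (sym z[t₂-s₂]≈s₁-t₁)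
                        (trans (*-congˡ t₂-s₂≈0) (zeroʳ z)))
          , sym (x-y≈0⇒x≈y t₂-s₂≈0) )

      from : ScalesDifference S z → 𝓔 S z
      from (v , u , (v≉0 , r , s , r∈ , s∈ , v≈r-s) , (p , q , p∈ , q∈ , u≈p-q) , zv≈u) =
        p , s , q , r , p∈ , s∈ , q∈ , r∈ ,
        (λ (_ , s≈r) → v≉0 (trans v≈r-s (x≈y⇒x-y≈0 (sym s≈r)))) ,
        x-u≈v-y⇒x+y≈u+v (sym (begin
          z * r - z * s  ≈⟨ sym (x[y-z]≈xy-xz z r s) ⟩
          z * (r - s)    ≈⟨ *-congˡ (sym v≈r-s) ⟩
          z * v          ≈⟨ zv≈u ⟩
          u              ≈⟨ u≈p-q ⟩
          p - q          ∎))
        where open import Relation.Binary.Reasoning.Setoid setoid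

    𝓔-zero : ∀ {v z} → NonzeroDifference S v → z ≈ 0# → 𝓔 S z
    𝓔-zero {v} {z} dv@(_ , p , _ , p∈ , _) z≈0 =
      Equivalence.from 𝓔⇔ScalesDifference
        (v , 0# , dv , (p , p , p∈ , p∈ , sym (-‿inverseʳ p)) ,
         trans (*-congʳ z≈0) (zeroˡ v))

    E⇒𝓔 : ∀ {u v z} → NonzeroDifference S u → NonzeroDifference S v →
          E[ u / v ] z → 𝓔 S z
    E⇒𝓔 {u} {v} {z} du dv e = Equivalence.from 𝓔⇔ScalesDifference (scales e)
      where
      scales : E[ u / v ] z → ScalesDifference S z
      scales (inj₁ zv≈u)                 = v , u , dv , proj₂ du , zv≈u
      scales (inj₂ (inj₁ zv≈-u))         = v , - u , dv , Difference-neg (proj₂ du) , zv≈-u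
      scales (inj₂ (inj₂ (inj₁ zu≈v)))   = u , v , du , proj₂ dv , zu≈v
      scales (inj₂ (inj₂ (inj₂ zu≈-v)))  = u , - v , du , Difference-neg (proj₂ dv) , zu≈-v

  E-swap : ∀ {u v z} → E[ u / v ] z → E[ v / u ] z
  E-swap (inj₁ h)                 = inj₂ (inj₂ (inj₁ h))
  E-swap (inj₂ (inj₁ h))          = inj₂ (inj₂ (inj₂ h))
  E-swap (inj₂ (inj₂ (inj₁ h)))   = inj₁ h
  E-swap (inj₂ (inj₂ (inj₂ h)))   = inj₂ (inj₁ h)

  ≈±⇒E : ∀ {u v z} → z * v ≈± u → E[ u / v ] z
  ≈±⇒E (inj₁ h) = inj₁ h
  ≈±⇒E (inj₂ h) = inj₂ (inj₁ h)

  E-resp-≈± : ∀ {u v U V z} → u ≈± U → v ≈± V → z * v ≈ u → E[ U / V ] z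
  E-resp-≈± {z = z} u≈±U v≈±V zv≈u =
    ≈±⇒E (≈±-trans (≈±-sym (*-preserves-≈± z v≈±V)) (≈±-respˡ zv≈u u≈±U))

  E-self : ∀ {u z} → ¬ (u ≈ 0#) → E[ u / u ] z → E[ 1# / 1# ] z
  E-self {u} {z} u≉0 e = ≈±⇒E (≈±-respˡ (*-identityʳ z) (z≈±1 e))
    where
    open RingProperties ring using (-1*x≈-x)
    z≈±1 : E[ u / u ] z → z ≈± 1#
    z≈±1 (inj₁ h)                = inj₁ (*-cancelʳ-nonzero u≉0 (trans h (sym (*-identityˡ u))))
    z≈±1 (inj₂ (inj₁ h))         = inj₂ (*-cancelʳ-nonzero u≉0 (trans h (sym (-1*x≈-x u))))
    z≈±1 (inj₂ (inj₂ (inj₁ h)))  = z≈±1 (inj₁ h)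
    z≈±1 (inj₂ (inj₂ (inj₂ h)))  = z≈±1 (inj₂ (inj₁ h))

  module _ {x : Carrier} where

    1∈Δ[0,1,x] : NonzeroDifference ⟦0,1, x ⟧ 1#
    1∈Δ[0,1,x] = 1≉0 , 1# , 0# , inj₂ (inj₁ refl) , inj₁ refl , sym (x-0≈x 1#)

    x∈Δ[0,1,x] : ¬ (x ≈ 0#) → NonzeroDifference ⟦0,1, x ⟧ x
    x∈Δ[0,1,x] x≉0 = x≉0 , x , 0# , inj₂ (inj₂ refl) , inj₁ refl , sym (x-0≈x x)

    x-1∈Δ[0,1,x] : ¬ (x ≈ 1#) → NonzeroDifference ⟦0,1, x ⟧ (x - 1#)
    x-1∈Δ[0,1,x] x≉1 =
      x≉1 ∘ x-y≈0⇒x≈y , x , 1# , inj₂ (inj₂ refl) , inj₂ (inj₁ refl) , refl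

data Point : Set where
  p0 p1 pa pb : Point

data Gap : Set where
  δ1 δa δb δa-1 δb-1 δa-b : Gap

module FourPointSet {c ℓ : Level} (F : Field c ℓ) (a b : Field.Carrier F) where
  open Field F
  open import Data.Product using (Σ; ∃; _,_)
  open FieldDefs F
  open FieldProperties F
  open Dilations F

  A B S : Carrier → Set ℓ
  A = ⟦0,1, a ⟧
  B = ⟦0,1, b ⟧
  S = ⟦0,1,_,_⟧ a b

  A⊆S : ∀ {x} → A x → S x
  A⊆S = map₂ (map₂ inj₁)

  B⊆S : ∀ {x} → B x → S x
  B⊆S = map₂ (map₂ inj₂)

  ⟦_⟧ₚ : Point → Carrier
  ⟦ p0 ⟧ₚ = 0#
  ⟦ p1 ⟧ₚ = 1#
  ⟦ pa ⟧ₚ = a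
  ⟦ pb ⟧ₚ = b

  ⟦_⟧ : Gap → Carrier
  ⟦ δ1 ⟧   = 1#
  ⟦ δa ⟧   = a
  ⟦ δb ⟧   = b
  ⟦ δa-1 ⟧ = a - 1#
  ⟦ δb-1 ⟧ = b - 1#
  ⟦ δa-b ⟧ = a - b

  point : ∀ {x} → S x → Σ Point λ P → x ≈ ⟦ P ⟧ₚ
  point (inj₁ x≈0)                 = p0 , x≈0
  point (inj₂ (inj₁ x≈1))          = p1 , x≈1
  point (inj₂ (inj₂ (inj₁ x≈a)))   = pa , x≈a
  point (inj₂ (inj₂ (inj₂ x≈b)))   = pb , x≈b

  point-difference : ∀ P Q → ⟦ P ⟧ₚ - ⟦ Q ⟧ₚ ≈ 0# ⊎ ∃ λ k → ⟦ P ⟧ₚ - ⟦ Q ⟧ₚ ≈± ⟦ k ⟧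
  point-difference p0 p0 = inj₁ (-‿inverseʳ 0#)
  point-difference p0 p1 = inj₂ (δ1 , inj₂ (0-x≈-x 1#))
  point-difference p0 pa = inj₂ (δa , inj₂ (0-x≈-x a))
  point-difference p0 pb = inj₂ (δb , inj₂ (0-x≈-x b))
  point-difference p1 p0 = inj₂ (δ1 , inj₁ (x-0≈x 1#))
  point-difference p1 p1 = inj₁ (-‿inverseʳ 1#)
  point-difference p1 pa = inj₂ (δa-1 , inj₂ (x-y≈-[y-x] 1# a))
  point-difference p1 pb = inj₂ (δb-1 , inj₂ (x-y≈-[y-x] 1# b))
  point-difference pa p0 = inj₂ (δa , inj₁ (x-0≈x a))
  point-difference pa p1 = inj₂ (δa-1 , inj₁ refl)
  point-difference pa pa = inj₁ (-‿inverseʳ a)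
  point-difference pa pb = inj₂ (δa-b , inj₁ refl)
  point-difference pb p0 = inj₂ (δb , inj₁ (x-0≈x b))
  point-difference pb p1 = inj₂ (δb-1 , inj₁ refl)
  point-difference pb pa = inj₂ (δa-b , inj₂ (x-y≈-[y-x] b a))
  point-difference pb pb = inj₁ (-‿inverseʳ b)

  difference-classification : ∀ {u} → Difference S u → u ≈ 0# ⊎ ∃ λ k → u ≈± ⟦ k ⟧
  difference-classification {u} (p , q , p∈ , q∈ , u≈p-q)
    with point p∈ | point q∈
  ... | P , p≈P | Q , q≈Q =
    Sum.map (trans u≈P-Q) (λ (k , ±) → k , ≈±-respˡ u≈P-Q ±) (point-difference P Q)
    where
    u≈P-Q : u ≈ ⟦ P ⟧ₚ - ⟦ Q ⟧ₚ
    u≈P-Q = trans u≈p-q (+-cong p≈P (-‿cong q≈Q))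

  module _ (a≉0 : ¬ (a ≈ 0#)) (a≉1 : ¬ (a ≈ 1#)) (b≉0 : ¬ (b ≈ 0#)) (b≉1 : ¬ (b ≈ 1#))
           (a≉b : ¬ (a ≈ b)) (z : Carrier) where

    RHS : Set (c ⊔ ℓ)
    RHS = 𝓔 A z ⊎ 𝓔 B z
        ⊎ E[ a - b ] z ⊎ E[ (a - b) / a ] z ⊎ E[ (a - b) / b ] z
        ⊎ E[ (a - 1#) / b ] z ⊎ E[ (b - 1#) / a ] z ⊎ E[ (a - 1#) / (b - 1#) ] z
        ⊎ E[ (a - 1#) / (a - b) ] z ⊎ E[ (b - 1#) / (a - b) ] z ⊎ E[ a / b ] z

    1∈ΔA : NonzeroDifference A 1#
    1∈ΔA = 1∈Δ[0,1,x]

    a∈ΔA : NonzeroDifference A a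
    a∈ΔA = x∈Δ[0,1,x] a≉0

    a-1∈ΔA : NonzeroDifference A (a - 1#)
    a-1∈ΔA = x-1∈Δ[0,1,x] a≉1

    1∈ΔB : NonzeroDifference B 1#
    1∈ΔB = 1∈Δ[0,1,x]

    b∈ΔB : NonzeroDifference B b
    b∈ΔB = x∈Δ[0,1,x] b≉0

    b-1∈ΔB : NonzeroDifference B (b - 1#)
    b-1∈ΔB = x-1∈Δ[0,1,x] b≉1

    a-b≉0 : ¬ (a - b ≈ 0#)
    a-b≉0 = a≉b ∘ x-y≈0⇒x≈y

    gap∈ΔS : ∀ k → NonzeroDifference S ⟦ k ⟧
    gap∈ΔS δ1   = NonzeroDifference-mono A⊆S 1∈ΔA
    gap∈ΔS δa   = NonzeroDifference-mono A⊆S a∈ΔA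
    gap∈ΔS δb   = NonzeroDifference-mono B⊆S b∈ΔB
    gap∈ΔS δa-1 = NonzeroDifference-mono A⊆S a-1∈ΔA
    gap∈ΔS δb-1 = NonzeroDifference-mono B⊆S b-1∈ΔB
    gap∈ΔS δa-b = a-b≉0 , a , b , inj₂ (inj₂ (inj₁ refl)) , inj₂ (inj₂ (inj₂ refl)) , refl

    viaA : ∀ {u v} → NonzeroDifference A u → NonzeroDifference A v → E[ u / v ] z → RHS
    viaA du dv = inj₁ ∘ E⇒𝓔 du dv

    viaB : ∀ {u v} → NonzeroDifference B u → NonzeroDifference B v → E[ u / v ] z → RHS
    viaB du dv = inj₂ ∘ inj₁ ∘ E⇒𝓔 du dv

    rhs[a-b] : E[ a - b ] z → RHS
    rhs[a-b] = inj₂ ∘ inj₂ ∘ inj₁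

    rhs[a-b/a] : E[ (a - b) / a ] z → RHS
    rhs[a-b/a] = inj₂ ∘ inj₂ ∘ inj₂ ∘ inj₁

    rhs[a-b/b] : E[ (a - b) / b ] z → RHS
    rhs[a-b/b] = inj₂ ∘ inj₂ ∘ inj₂ ∘ inj₂ ∘ inj₁

    rhs[a-1/b] : E[ (a - 1#) / b ] z → RHS
    rhs[a-1/b] = inj₂ ∘ inj₂ ∘ inj₂ ∘ inj₂ ∘ inj₂ ∘ inj₁

    rhs[b-1/a] : E[ (b - 1#) / a ] z → RHS
    rhs[b-1/a] = inj₂ ∘ inj₂ ∘ inj₂ ∘ inj₂ ∘ inj₂ ∘ inj₂ ∘ inj₁

    rhs[a-1/b-1] : E[ (a - 1#) / (b - 1#) ] z → RHS
    rhs[a-1/b-1] = inj₂ ∘ inj₂ ∘ inj₂ ∘ inj₂ ∘ inj₂ ∘ inj₂ ∘ inj₂ ∘ inj₁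

    rhs[a-1/a-b] : E[ (a - 1#) / (a - b) ] z → RHS
    rhs[a-1/a-b] = inj₂ ∘ inj₂ ∘ inj₂ ∘ inj₂ ∘ inj₂ ∘ inj₂ ∘ inj₂ ∘ inj₂ ∘ inj₁

    rhs[b-1/a-b] : E[ (b - 1#) / (a - b) ] z → RHS
    rhs[b-1/a-b] = inj₂ ∘ inj₂ ∘ inj₂ ∘ inj₂ ∘ inj₂ ∘ inj₂ ∘ inj₂ ∘ inj₂ ∘ inj₂ ∘ inj₁

    rhs[a/b] : E[ a / b ] z → RHS
    rhs[a/b] = inj₂ ∘ inj₂ ∘ inj₂ ∘ inj₂ ∘ inj₂ ∘ inj₂ ∘ inj₂ ∘ inj₂ ∘ inj₂ ∘ inj₂

    ratio⇒RHS : ∀ i j → E[ ⟦ i ⟧ / ⟦ j ⟧ ] z → RHS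
    ratio⇒RHS δ1   δ1   = viaA 1∈ΔA 1∈ΔA
    ratio⇒RHS δ1   δa   = viaA 1∈ΔA a∈ΔA
    ratio⇒RHS δ1   δb   = viaB 1∈ΔB b∈ΔB
    ratio⇒RHS δ1   δa-1 = viaA 1∈ΔA a-1∈ΔA
    ratio⇒RHS δ1   δb-1 = viaB 1∈ΔB b-1∈ΔB
    ratio⇒RHS δ1   δa-b = rhs[a-b] ∘ E-swap
    ratio⇒RHS δa   δ1   = viaA a∈ΔA 1∈ΔA
    ratio⇒RHS δa   δa   = viaA a∈ΔA a∈ΔA
    ratio⇒RHS δa   δb   = rhs[a/b]
    ratio⇒RHS δa   δa-1 = viaA a∈ΔA a-1∈ΔA
    ratio⇒RHS δa   δb-1 = rhs[b-1/a] ∘ E-swap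
    ratio⇒RHS δa   δa-b = rhs[a-b/a] ∘ E-swap
    ratio⇒RHS δb   δ1   = viaB b∈ΔB 1∈ΔB
    ratio⇒RHS δb   δa   = rhs[a/b] ∘ E-swap
    ratio⇒RHS δb   δb   = viaB b∈ΔB b∈ΔB
    ratio⇒RHS δb   δa-1 = rhs[a-1/b] ∘ E-swap
    ratio⇒RHS δb   δb-1 = viaB b∈ΔB b-1∈ΔB
    ratio⇒RHS δb   δa-b = rhs[a-b/b] ∘ E-swap
    ratio⇒RHS δa-1 δ1   = viaA a-1∈ΔA 1∈ΔA
    ratio⇒RHS δa-1 δa   = viaA a-1∈ΔA a∈ΔA
    ratio⇒RHS δa-1 δb   = rhs[a-1/b]
    ratio⇒RHS δa-1 δa-1 = viaA a-1∈ΔA a-1∈ΔA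
    ratio⇒RHS δa-1 δb-1 = rhs[a-1/b-1]
    ratio⇒RHS δa-1 δa-b = rhs[a-1/a-b]
    ratio⇒RHS δb-1 δ1   = viaB b-1∈ΔB 1∈ΔB
    ratio⇒RHS δb-1 δa   = rhs[b-1/a]
    ratio⇒RHS δb-1 δb   = viaB b-1∈ΔB b∈ΔB
    ratio⇒RHS δb-1 δa-1 = rhs[a-1/b-1] ∘ E-swap
    ratio⇒RHS δb-1 δb-1 = viaB b-1∈ΔB b-1∈ΔB
    ratio⇒RHS δb-1 δa-b = rhs[b-1/a-b]
    ratio⇒RHS δa-b δ1   = rhs[a-b]
    ratio⇒RHS δa-b δa   = rhs[a-b/a]
    ratio⇒RHS δa-b δb   = rhs[a-b/b]
    ratio⇒RHS δa-b δa-1 = rhs[a-1/a-b] ∘ E-swap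
    ratio⇒RHS δa-b δb-1 = rhs[b-1/a-b] ∘ E-swap
    ratio⇒RHS δa-b δa-b = viaA 1∈ΔA 1∈ΔA ∘ E-self a-b≉0

    forward : 𝓔 S z → RHS
    forward e with Equivalence.to 𝓔⇔ScalesDifference e
    ... | v , u , (v≉0 , dv) , du , zv≈u
        with difference-classification dv | difference-classification du
    ... | inj₁ v≈0 | _ = ⊥-elim (v≉0 v≈0)
    ... | inj₂ _ | inj₁ u≈0 = inj₁ (𝓔-zero 1∈ΔA (x*y≈0⇒x≈0 v≉0 (trans zv≈u u≈0)))
    ... | inj₂ (j , v≈±j) | inj₂ (i , u≈±i) = ratio⇒RHS i j (E-resp-≈± u≈±i v≈±j zv≈u)

    backward : RHS → 𝓔 S z
    backward =
      [ 𝓔-mono A⊆S , [ 𝓔-mono B⊆S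
      , [ ratio δa-b δ1 , [ ratio δa-b δa , [ ratio δa-b δb
      , [ ratio δa-1 δb , [ ratio δb-1 δa , [ ratio δa-1 δb-1
      , [ ratio δa-1 δa-b , [ ratio δb-1 δa-b , ratio δa δb ]′ ]′ ]′ ]′ ]′ ]′ ]′ ]′ ]′ ]′
      where
      ratio : ∀ i j → E[ ⟦ i ⟧ / ⟦ j ⟧ ] z → 𝓔 S z
      ratio i j = E⇒𝓔 (gap∈ΔS i) (gap∈ΔS j)

    𝓔-four-points : 𝓔 S z ⇔ RHS
    𝓔-four-points = mk⇔ forward backward

mainTheorem7 : ∀ {c ℓ : Level} (F : Field c ℓ) → let open Field F in let open FieldDefs F in
    (a b : Carrier) → ¬ (a ≈ 0#) → ¬ (a ≈ 1#) → ¬ (b ≈ 0#) → ¬ (b ≈ 1#) → ¬ (a ≈ b) →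
    (z : Carrier) →
    𝓔 ⟦0,1, a , b ⟧ z ⇔
      (𝓔 ⟦0,1, a ⟧ z ⊎ 𝓔 ⟦0,1, b ⟧ z
       ⊎ E[ a - b ] z ⊎ E[ (a - b) / a ] z ⊎ E[ (a - b) / b ] z
       ⊎ E[ (a - 1#) / b ] z ⊎ E[ (b - 1#) / a ] z ⊎ E[ (a - 1#) / (b - 1#) ] z
       ⊎ E[ (a - 1#) / (a - b) ] z ⊎ E[ (b - 1#) / (a - b) ] z ⊎ E[ a / b ] z)
mainTheorem7 F a b = FourPointSet.𝓔-four-points F a b
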